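{- Let $r\in\mathbb{Z}$ with $r\ge2$ and put $s=-r$. Define $$L(X)=X^3+\frac{4rs-r-s+3}{2}X^2+\frac{ -4rs(r+s-1)+1}{2}X+\frac{rs(r^2+2(3s+1)r+s^2+2s+2)}{2},$$ $M(X)=L(X)-4(X+rs)^2$, and $S(X)=s_4X^4+s_3X^3+s_2X^2+s_1X+s_0$ with $s_4=(r+s+1)^2$, $s_3=4sr^3+8s(s+1)r^2+(4s^3+8s^2+8s+2)r+2s+2$, $s_2=2s(2s-1)r^4+2s(s+1)(4s-3)r^3+2s(2s^3+s^2+6s+4)r^2-2s(s+1)(s^2+2s-6)r+1$, $s_1=-2rs\big(2sr^4+6s(s+1)r^3+(6s^3-4s^2-8s-1)r^2+2(s+1)(s^3+2s^2-6s-1)r-s^2-2s-2\big)$, $s_0=r^2s^2\big(r^4+4(s+1)r^3+(22s^2+28s+8)r^2+4(s+1)(s^2+6s+2)r+(s^2+2s+2)^2\big)$. Let $z\in\mathbb{Z}$ with $r^2<z$. Then the following are equivalent: (i) $S(z)\ge0$ and $M(z)\le\frac{\sqrt{S(z)}}{2}\le L(z)$; (ii) $S(z)\ge0$ and $M(z)\le-\frac{\sqrt{S(z)}}{2}\le L(z)$; (iii) $S(z)=0$; (iv) $z\in\{2r^2-1,\,2r^2\}$. -}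

module Defs where

open import Data.Integer using (ℤ; +_; -_; _+_; _-_; _*_; _≤_)
open import Data.Product using (_×_)
open import Data.Sum using (_⊎_)

-- Convention: the polynomial L(X) has half-integer coefficients; we work with
-- its numerator L2 = 2·L (an integer polynomial), and M2 = 2·M = L2 - 8(X+rs)².

cube : ℤ → ℤ
cube x = x * x * x

sq : ℤ → ℤ
sq x = x * x

L2 : ℤ → ℤ → ℤ → ℤ
L2 r s X =
  + 2 * cube X
  + (+ 4 * r * s - r - s + + 3) * sq X
  + (- (+ 4 * r * s * (r + s - + 1)) + + 1) * X
  + r * s * (sq r + + 2 * (+ 3 * s + + 1) * r + sq s + + 2 * s + + 2)

M2 : ℤ → ℤ → ℤ → ℤ
M2 r s X = L2 r s X - + 8 * sq (X + r * s)

s4 s3 s2 s1 s0 : ℤ → ℤ → ℤ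
s4 r s = sq (r + s + + 1)
s3 r s = + 4 * s * cube r + + 8 * s * (s + + 1) * sq r
       + (+ 4 * cube s + + 8 * sq s + + 8 * s + + 2) * r + + 2 * s + + 2
s2 r s = + 2 * s * (+ 2 * s - + 1) * sq (sq r)
       + + 2 * s * (s + + 1) * (+ 4 * s - + 3) * cube r
       + + 2 * s * (+ 2 * cube s + sq s + + 6 * s + + 4) * sq r
       - + 2 * s * (s + + 1) * (sq s + + 2 * s - + 6) * r + + 1
s1 r s = - (+ 2 * r * s *
           ( + 2 * s * sq (sq r) + + 6 * s * (s + + 1) * cube r
           + (+ 6 * cube s - + 4 * sq s - + 8 * s - + 1) * sq r
           + + 2 * (s + + 1) * (cube s + + 2 * sq s - + 6 * s - + 1) * r
           - sq s - + 2 * s - + 2))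
s0 r s = sq r * sq s *
         ( sq (sq r) + + 4 * (s + + 1) * cube r
         + (+ 22 * sq s + + 28 * s + + 8) * sq r
         + + 4 * (s + + 1) * (sq s + + 6 * s + + 2) * r
         + sq (sq s + + 2 * s + + 2))

S : ℤ → ℤ → ℤ → ℤ
S r s X = s4 r s * sq (sq X) + s3 r s * cube X + s2 r s * sq X + s1 r s * X + s0 r s

-- Comparisons with the (real) square root √N of an integer N ≥ 0, written out
-- over ℤ (there are no reals in the library):
--   a ≤ √N   ⟺  a ≤ 0  or  a² ≤ N
--   √N ≤ b   ⟺  0 ≤ b  and N ≤ b²
--   a ≤ -√N  ⟺  a ≤ 0  and N ≤ a²
--   -√N ≤ b  ⟺  0 ≤ b  or  b² ≤ N
_≤√_ : ℤ → ℤ → Set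
a ≤√ N = a ≤ + 0 ⊎ sq a ≤ N

√_≤_ : ℤ → ℤ → Set
√ N ≤ b = + 0 ≤ b × N ≤ sq b

_≤-√_ : ℤ → ℤ → Set
a ≤-√ N = a ≤ + 0 × N ≤ sq a

-√_≤_ : ℤ → ℤ → Set
-√ N ≤ b = + 0 ≤ b ⊎ sq b ≤ N

{-# OPTIONS --safe #-}
-- For s = -r all three polynomials are polynomials in U = r² and w = z - 2U.
-- S = q² with q = (w + 1) w, a product of consecutive integers, so √S = q ≥ 0
-- and S vanishes exactly for w ∈ {-1, 0}, i.e. z ∈ {2U - 1, 2U}; there
-- 2M ≤ 0 ≤ 2L, so both (i) and (ii) hold. Off the roots q > 0, and
--   2M - q = 2w (z (z - 3) + 2U),   -q - 2L = -2 (w + 1) (z² + z - 2U)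
-- show q < 2M when w > 0, and 2L < -q when w < -1 (this is where U < z is
-- used). Either way neither of ±q lies in [2M, 2L], so (i) and (ii) fail.
module Submission where

open import Defs
open import Data.Integer using (ℤ; +_; -_; _+_; _-_; _*_; _≤_; _<_)
open import Data.Product using (_×_)
open import Data.Sum using (_⊎_)
open import Relation.Binary.PropositionalEquality using (_≡_)
open import Function.Bundles using (_⇔_)

open import Data.Empty using (⊥-elim)
open import Data.Integer using (+[1+_]; -[1+_]; +≤+; +<+; nonNegative; positive)
import Data.Integer.Properties as ℤ
open import Data.Integer.Tactic.RingSolver using (ring) renaming (solve to solve-in)
open import Data.List using (_∷_; [])
open import Data.Nat using (ℕ; suc; z≤n; s≤s)
open import Data.Product using (_,_)
open import Data.Sum using (inj₁; inj₂)
open import Data.Sum.Function.Propositional using (_⊎-⇔_)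
open import Function.Bundles using (mk⇔; Equivalence)
import Function.Properties.Equivalence as ⇔
open import Relation.Binary.PropositionalEquality using (refl; sym; trans; cong; subst)
open import Relation.Nullary using (¬_; contradiction)
open import Tactic.RingSolver.NonReflective ring using (Expr; Κ; _⊕_; _⊗_; ⊝_; solve; _⊜_)

pronic : ℤ → ℤ
pronic w = (w + + 1) * w

-- Syntax trees of the polynomials of Defs for the non-reflective ring solver
-- (the reflective one treats defined functions as opaque): each tree
-- evaluates definitionally to the corresponding function of Defs.
module Syntax {n : ℕ} where
  infixl 6 _⊖_
  _⊖_ : Expr ℤ n → Expr ℤ n → Expr ℤ n
  x ⊖ y = x ⊕ ⊝ y

  sqᵉ cubeᵉ pronicᵉ : Expr ℤ n → Expr ℤ n
  sqᵉ x = x ⊗ x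
  cubeᵉ x = x ⊗ x ⊗ x
  pronicᵉ w = (w ⊕ Κ (+ 1)) ⊗ w

  L2ᵉ M2ᵉ Sᵉ : Expr ℤ n → Expr ℤ n → Expr ℤ n → Expr ℤ n
  L2ᵉ r s X =
    Κ (+ 2) ⊗ cubeᵉ X
    ⊕ (Κ (+ 4) ⊗ r ⊗ s ⊖ r ⊖ s ⊕ Κ (+ 3)) ⊗ sqᵉ X
    ⊕ (⊝ (Κ (+ 4) ⊗ r ⊗ s ⊗ (r ⊕ s ⊖ Κ (+ 1))) ⊕ Κ (+ 1)) ⊗ X
    ⊕ r ⊗ s ⊗ (sqᵉ r ⊕ Κ (+ 2) ⊗ (Κ (+ 3) ⊗ s ⊕ Κ (+ 1)) ⊗ r ⊕ sqᵉ s ⊕ Κ (+ 2) ⊗ s ⊕ Κ (+ 2))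
  M2ᵉ r s X = L2ᵉ r s X ⊖ Κ (+ 8) ⊗ sqᵉ (X ⊕ r ⊗ s)
  Sᵉ r s X = s4ᵉ ⊗ sqᵉ (sqᵉ X) ⊕ s3ᵉ ⊗ cubeᵉ X ⊕ s2ᵉ ⊗ sqᵉ X ⊕ s1ᵉ ⊗ X ⊕ s0ᵉ
    where
    s4ᵉ = sqᵉ (r ⊕ s ⊕ Κ (+ 1))
    s3ᵉ = Κ (+ 4) ⊗ s ⊗ cubeᵉ r ⊕ Κ (+ 8) ⊗ s ⊗ (s ⊕ Κ (+ 1)) ⊗ sqᵉ r
        ⊕ (Κ (+ 4) ⊗ cubeᵉ s ⊕ Κ (+ 8) ⊗ sqᵉ s ⊕ Κ (+ 8) ⊗ s ⊕ Κ (+ 2)) ⊗ r ⊕ Κ (+ 2) ⊗ s ⊕ Κ (+ 2)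
    s2ᵉ = Κ (+ 2) ⊗ s ⊗ (Κ (+ 2) ⊗ s ⊖ Κ (+ 1)) ⊗ sqᵉ (sqᵉ r)
        ⊕ Κ (+ 2) ⊗ s ⊗ (s ⊕ Κ (+ 1)) ⊗ (Κ (+ 4) ⊗ s ⊖ Κ (+ 3)) ⊗ cubeᵉ r
        ⊕ Κ (+ 2) ⊗ s ⊗ (Κ (+ 2) ⊗ cubeᵉ s ⊕ sqᵉ s ⊕ Κ (+ 6) ⊗ s ⊕ Κ (+ 4)) ⊗ sqᵉ r
        ⊖ Κ (+ 2) ⊗ s ⊗ (s ⊕ Κ (+ 1)) ⊗ (sqᵉ s ⊕ Κ (+ 2) ⊗ s ⊖ Κ (+ 6)) ⊗ r ⊕ Κ (+ 1)
    s1ᵉ = ⊝ (Κ (+ 2) ⊗ r ⊗ s ⊗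
            ( Κ (+ 2) ⊗ s ⊗ sqᵉ (sqᵉ r) ⊕ Κ (+ 6) ⊗ s ⊗ (s ⊕ Κ (+ 1)) ⊗ cubeᵉ r
            ⊕ (Κ (+ 6) ⊗ cubeᵉ s ⊖ Κ (+ 4) ⊗ sqᵉ s ⊖ Κ (+ 8) ⊗ s ⊖ Κ (+ 1)) ⊗ sqᵉ r
            ⊕ Κ (+ 2) ⊗ (s ⊕ Κ (+ 1)) ⊗ (cubeᵉ s ⊕ Κ (+ 2) ⊗ sqᵉ s ⊖ Κ (+ 6) ⊗ s ⊖ Κ (+ 1)) ⊗ r
            ⊖ sqᵉ s ⊖ Κ (+ 2) ⊗ s ⊖ Κ (+ 2)))
    s0ᵉ = sqᵉ r ⊗ sqᵉ s ⊗
            ( sqᵉ (sqᵉ r) ⊕ Κ (+ 4) ⊗ (s ⊕ Κ (+ 1)) ⊗ cubeᵉ r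
            ⊕ (Κ (+ 22) ⊗ sqᵉ s ⊕ Κ (+ 28) ⊗ s ⊕ Κ (+ 8)) ⊗ sqᵉ r
            ⊕ Κ (+ 4) ⊗ (s ⊕ Κ (+ 1)) ⊗ (sqᵉ s ⊕ Κ (+ 6) ⊗ s ⊕ Κ (+ 2)) ⊗ r
            ⊕ sqᵉ (sqᵉ s ⊕ Κ (+ 2) ⊗ s ⊕ Κ (+ 2)))

open Syntax

0<i-j⇒j<i : ∀ {i j} → + 0 < i - j → j < i
0<i-j⇒j<i 0<i-j = ℤ.≰⇒> (λ i≤j → ℤ.<⇒≱ 0<i-j (ℤ.i≤j⇒i-j≤0 i≤j))

i<j⇒0<j-i : ∀ {i j} → i < j → + 0 < j - i
i<j⇒0<j-i {i} {j} i<j = subst (_< j - i) (ℤ.+-inverseʳ i) (ℤ.+-monoˡ-< (- i) i<j)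

i≤-j⇒j≤-i : ∀ {i j} → i ≤ - j → j ≤ - i
i≤-j⇒j≤-i {i} {j} i≤-j = subst (_≤ - i) (ℤ.neg-involutive j) (ℤ.neg-mono-≤ i≤-j)

-i≤j⇒-j≤i : ∀ {i j} → - i ≤ j → - j ≤ i
-i≤j⇒-j≤i {i} {j} -i≤j = subst (- j ≤_) (ℤ.neg-involutive i) (ℤ.neg-mono-≤ -i≤j)

0≤i⇒-i≤i : ∀ {i} → + 0 ≤ i → - i ≤ i
0≤i⇒-i≤i 0≤i = ℤ.≤-trans (ℤ.neg-mono-≤ 0≤i) 0≤i

0<i∧0<j⇒0<i*j : ∀ {i j} → + 0 < i → + 0 < j → + 0 < i * j
0<i∧0<j⇒0<i*j {i} {j} 0<i 0<j =
  subst (_< i * j) (ℤ.*-zeroʳ i) (ℤ.*-monoˡ-<-pos i {{positive 0<i}} 0<j)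

0≤i∧0≤j⇒0≤i*j : ∀ {i j} → + 0 ≤ i → + 0 ≤ j → + 0 ≤ i * j
0≤i∧0≤j⇒0≤i*j {i} {j} 0≤i 0≤j =
  subst (_≤ i * j) (ℤ.*-zeroʳ i) (ℤ.*-monoˡ-≤-nonNeg i {{nonNegative 0≤i}} 0≤j)

sq-nonNeg : ∀ i → + 0 ≤ sq i
sq-nonNeg (+ n)    = 0≤i∧0≤j⇒0≤i*j {+ n} {+ n} (+≤+ z≤n) (+≤+ z≤n)
sq-nonNeg -[1+ n ] = +≤+ z≤n

sq-neg : ∀ i → sq (- i) ≡ sq i
sq-neg = solve 1 (λ i → sqᵉ (⊝ i) ⊜ sqᵉ i) refl

sq≡0⇒≡0 : ∀ {i} → sq i ≡ + 0 → i ≡ + 0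
sq≡0⇒≡0 {+ 0}       _  = refl
sq≡0⇒≡0 {+[1+ n ]}  ()
sq≡0⇒≡0 { -[1+ n ]} ()

sq-mono-< : ∀ {i j} → + 0 ≤ i → i < j → sq i < sq j
sq-mono-< {i} {j} 0≤i i<j = begin-strict
  i * i ≤⟨ ℤ.*-monoˡ-≤-nonNeg i {{nonNegative 0≤i}} (ℤ.<⇒≤ i<j) ⟩
  i * j <⟨ ℤ.*-monoʳ-<-pos j {{positive (ℤ.≤-<-trans 0≤i i<j)}} i<j ⟩
  j * j ∎
  where open ℤ.≤-Reasoning

sq-cancel-≤ : ∀ {i j} → + 0 ≤ j → sq i ≤ sq j → i ≤ j
sq-cancel-≤ 0≤j i²≤j² = ℤ.≮⇒≥ (λ j<i → ℤ.<⇒≱ (sq-mono-< 0≤j j<i) i²≤j²)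

≤√sq⇒≤ : ∀ {a q} → + 0 ≤ q → a ≤√ sq q → a ≤ q
≤√sq⇒≤ 0≤q (inj₁ a≤0)   = ℤ.≤-trans a≤0 0≤q
≤√sq⇒≤ 0≤q (inj₂ a²≤q²) = sq-cancel-≤ 0≤q a²≤q²

√sq≤⇒≤ : ∀ {q b} → √ sq q ≤ b → q ≤ b
√sq≤⇒≤ (0≤b , q²≤b²) = sq-cancel-≤ 0≤b q²≤b²

≤-√sq⇒≤- : ∀ {a q} → a ≤-√ sq q → a ≤ - q
≤-√sq⇒≤- {a} {q} (a≤0 , q²≤a²) =
  i≤-j⇒j≤-i (sq-cancel-≤ (ℤ.neg-mono-≤ a≤0) (subst (sq q ≤_) (sym (sq-neg a)) q²≤a²))

-√sq≤⇒-≤ : ∀ {q b} → + 0 ≤ q → -√ sq q ≤ b → - q ≤ b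
-√sq≤⇒-≤ 0≤q (inj₁ 0≤b)       = ℤ.≤-trans (ℤ.neg-mono-≤ 0≤q) 0≤b
-√sq≤⇒-≤ {q} {b} 0≤q (inj₂ b²≤q²) =
  -i≤j⇒-j≤i (sq-cancel-≤ 0≤q (subst (_≤ sq q) (sym (sq-neg b)) b²≤q²))

Between⁺ Between⁻ : ℤ → ℤ → ℤ → Set
Between⁺ m N l = + 0 ≤ N × m ≤√ N × √ N ≤ l
Between⁻ m N l = + 0 ≤ N × m ≤-√ N × -√ N ≤ l

Between⁺⇒≤ : ∀ {m q l} → + 0 ≤ q → Between⁺ m (sq q) l → m ≤ q × - q ≤ l
Between⁺⇒≤ 0≤q (_ , m≤√ , √≤l) =
  ≤√sq⇒≤ 0≤q m≤√ , ℤ.≤-trans (0≤i⇒-i≤i 0≤q) (√sq≤⇒≤ √≤l)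

Between⁻⇒≤ : ∀ {m q l} → + 0 ≤ q → Between⁻ m (sq q) l → m ≤ q × - q ≤ l
Between⁻⇒≤ 0≤q (_ , m≤-√ , -√≤l) =
  ℤ.≤-trans (≤-√sq⇒≤- m≤-√) (0≤i⇒-i≤i 0≤q) , -√sq≤⇒-≤ 0≤q -√≤l

data Position (q m l : ℤ) : Set where
  zero-inside : q ≡ + 0 → m ≤ + 0 × + 0 ≤ l → Position q m l
  outside     : + 0 < q → q < m ⊎ l < - q → Position q m l

outside⇒≰ : ∀ {q m l} → q < m ⊎ l < - q → ¬ (m ≤ q × - q ≤ l)
outside⇒≰ (inj₁ q<m)  (m≤q , _)   = ℤ.<⇒≱ q<m m≤q
outside⇒≰ (inj₂ l<-q) (_ , -q≤l) = ℤ.<⇒≱ l<-q -q≤l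

Between⇔≡0 : ∀ {N q m l} → N ≡ sq q → Position q m l →
             (Between⁺ m N l ⇔ N ≡ + 0) × (Between⁻ m N l ⇔ N ≡ + 0)
Between⇔≡0 {m = m} {l} refl (zero-inside refl (m≤0 , 0≤l)) =
  mk⇔ (λ _ → refl) (λ _ → ℤ.≤-refl , inj₁ m≤0 , 0≤l , sq-nonNeg l) ,
  mk⇔ (λ _ → refl) (λ _ → ℤ.≤-refl , (m≤0 , sq-nonNeg m) , inj₁ 0≤l)
Between⇔≡0 {q = q} refl (outside 0<q out) =
  mk⇔ (λ between → contradiction (Between⁺⇒≤ (ℤ.<⇒≤ 0<q) between) (outside⇒≰ out)) q²≢0 ,
  mk⇔ (λ between → contradiction (Between⁻⇒≤ (ℤ.<⇒≤ 0<q) between) (outside⇒≰ out)) q²≢0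
  where
  q²≢0 : ∀ {A : Set} → sq q ≡ + 0 → A
  q²≢0 q²≡0 = ⊥-elim (ℤ.<⇒≢ 0<q (sym (sq≡0⇒≡0 q²≡0)))

S≡sq[pronic] : ∀ r z → S r (- r) z ≡ sq (pronic (z - + 2 * (r * r)))
S≡sq[pronic] = solve 2 (λ r z → Sᵉ r (⊝ r) z ⊜ sqᵉ (pronicᵉ (z ⊖ Κ (+ 2) ⊗ (r ⊗ r)))) refl

M2-pronic≡ : ∀ r z → M2 r (- r) z - pronic (z - + 2 * (r * r))
                     ≡ + 2 * (z - + 2 * (r * r)) * (z * (z - + 3) + + 2 * (r * r))
M2-pronic≡ = solve 2 (λ r z → let w = z ⊖ Κ (+ 2) ⊗ (r ⊗ r) in
  M2ᵉ r (⊝ r) z ⊖ pronicᵉ w ⊜ Κ (+ 2) ⊗ w ⊗ (z ⊗ (z ⊖ Κ (+ 3)) ⊕ Κ (+ 2) ⊗ (r ⊗ r))) refl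

-pronic-L2≡ : ∀ r z → - pronic (z - + 2 * (r * r)) - L2 r (- r) z
                      ≡ - (+ 2 * (z - + 2 * (r * r) + + 1)) * (sq z + z - + 2 * (r * r))
-pronic-L2≡ = solve 2 (λ r z → let w = z ⊖ Κ (+ 2) ⊗ (r ⊗ r) in
  ⊝ pronicᵉ w ⊖ L2ᵉ r (⊝ r) z ⊜ ⊝ (Κ (+ 2) ⊗ (w ⊕ Κ (+ 1))) ⊗ (sqᵉ z ⊕ z ⊖ Κ (+ 2) ⊗ (r ⊗ r))) refl

L2-at-2r²-1 : ∀ r → L2 r (- r) (+ 2 * (r * r) - + 1) ≡ + 0
L2-at-2r²-1 = solve 1 (λ r → L2ᵉ r (⊝ r) (Κ (+ 2) ⊗ (r ⊗ r) ⊖ Κ (+ 1)) ⊜ Κ (+ 0)) refl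

M2-at-2r²-1 : ∀ r → M2 r (- r) (+ 2 * (r * r) - + 1) ≡ - (+ 8 * sq (r * r - + 1))
M2-at-2r²-1 = solve 1 (λ r →
  M2ᵉ r (⊝ r) (Κ (+ 2) ⊗ (r ⊗ r) ⊖ Κ (+ 1)) ⊜ ⊝ (Κ (+ 8) ⊗ sqᵉ (r ⊗ r ⊖ Κ (+ 1)))) refl

L2-at-2r² : ∀ r → L2 r (- r) (+ 2 * (r * r)) ≡ + 8 * sq (r * r)
L2-at-2r² = solve 1 (λ r → L2ᵉ r (⊝ r) (Κ (+ 2) ⊗ (r ⊗ r)) ⊜ Κ (+ 8) ⊗ sqᵉ (r ⊗ r)) refl

M2-at-2r² : ∀ r → M2 r (- r) (+ 2 * (r * r)) ≡ + 0
M2-at-2r² = solve 1 (λ r → M2ᵉ r (⊝ r) (Κ (+ 2) ⊗ (r ⊗ r)) ⊜ Κ (+ 0)) refl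

pronic≡0⇔ : ∀ {w} → pronic w ≡ + 0 ⇔ (w ≡ -[1+ 0 ] ⊎ w ≡ + 0)
pronic≡0⇔ = mk⇔ to from
  where
  to : ∀ {w} → pronic w ≡ + 0 → w ≡ -[1+ 0 ] ⊎ w ≡ + 0
  to {+ 0}           _ = inj₂ refl
  to { -[1+ 0 ]}     _ = inj₁ refl
  to {+[1+ n ]}      ()
  to { -[1+ suc n ]} ()
  from : ∀ {w} → w ≡ -[1+ 0 ] ⊎ w ≡ + 0 → pronic w ≡ + 0
  from (inj₁ refl) = refl
  from (inj₂ refl) = refl

i-j≡k⇔i≡j+k : ∀ {i j k} → i - j ≡ k ⇔ i ≡ j + k
i-j≡k⇔i≡j+k {i} {j} {k} =
  mk⇔ (λ { refl → solve-in (i ∷ j ∷ []) }) (λ { refl → solve-in (j ∷ k ∷ []) })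

S≡0⇔root : ∀ r z → S r (- r) z ≡ + 0 ⇔ (z ≡ + 2 * (r * r) - + 1 ⊎ z ≡ + 2 * (r * r))
S≡0⇔root r z = ⇔.trans S≡0⇔pronic≡0 (⇔.trans pronic≡0⇔ (i-j≡k⇔i≡j+k ⊎-⇔ i-j≡0⇔i≡j))
  where
  S≡0⇔pronic≡0 : S r (- r) z ≡ + 0 ⇔ pronic (z - + 2 * (r * r)) ≡ + 0
  S≡0⇔pronic≡0 = mk⇔ (λ S≡0 → sq≡0⇒≡0 (trans (sym (S≡sq[pronic] r z)) S≡0))
                     (λ q≡0 → trans (S≡sq[pronic] r z) (cong sq q≡0))
  i-j≡0⇔i≡j : ∀ {i j} → i - j ≡ + 0 ⇔ i ≡ j
  i-j≡0⇔i≡j = mk⇔ (ℤ.i-j≡0⇒i≡j _ _) ℤ.i≡j⇒i-j≡0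

2U<z²+z : ∀ {U z} → + 0 ≤ U → U < z → + 2 * U < sq z + z
2U<z²+z {U} {z} 0≤U U<z = begin-strict
  + 2 * U  ≡⟨ solve-in (U ∷ []) ⟩
  U + U    <⟨ ℤ.+-mono-< U<z U<z ⟩
  z + z    ≤⟨ ℤ.+-monoˡ-≤ z z≤z² ⟩
  sq z + z ∎
  where
  open ℤ.≤-Reasoning
  0<z : + 0 < z
  0<z = ℤ.≤-<-trans 0≤U U<z
  z≤z² : z ≤ sq z
  z≤z² = subst (_≤ sq z) (ℤ.*-identityʳ z)
               (ℤ.*-monoˡ-≤-nonNeg z {{nonNegative (ℤ.<⇒≤ 0<z)}} (ℤ.i<j⇒suc[i]≤j 0<z))

0<z[z-3]+2U : ∀ {U z} → + 0 < U → + 2 * U < z → + 0 < z * (z - + 3) + + 2 * U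
0<z[z-3]+2U {U} {z} 0<U 2U<z =
  ℤ.+-mono-≤-< (0≤i∧0≤j⇒0≤i*j (ℤ.≤-trans (+≤+ z≤n) 3≤z) (ℤ.i≤j⇒0≤j-i 3≤z))
               (ℤ.*-monoˡ-<-pos (+ 2) 0<U)
  where
  3≤z : + 3 ≤ z
  3≤z = ℤ.≤-trans (ℤ.+-monoʳ-≤ (+ 1) (ℤ.*-monoˡ-≤-nonNeg (+ 2) (ℤ.i<j⇒suc[i]≤j 0<U)))
                  (ℤ.i<j⇒suc[i]≤j 2U<z)

M2≤0≤L2-at-roots : ∀ r z → z ≡ + 2 * (r * r) - + 1 ⊎ z ≡ + 2 * (r * r) →
                   M2 r (- r) z ≤ + 0 × + 0 ≤ L2 r (- r) z
M2≤0≤L2-at-roots r _ (inj₁ refl) =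
  subst (_≤ + 0) (sym (M2-at-2r²-1 r))
        (ℤ.neg-mono-≤ (0≤i∧0≤j⇒0≤i*j {+ 8} (+≤+ z≤n) (sq-nonNeg (r * r - + 1)))) ,
  ℤ.≤-reflexive (sym (L2-at-2r²-1 r))
M2≤0≤L2-at-roots r _ (inj₂ refl) =
  ℤ.≤-reflexive (M2-at-2r² r) ,
  subst (+ 0 ≤_) (sym (L2-at-2r² r)) (0≤i∧0≤j⇒0≤i*j {+ 8} (+≤+ z≤n) (sq-nonNeg (r * r)))

position : ∀ r z → + 0 < r * r → r * r < z →
           Position (pronic (z - + 2 * (r * r))) (M2 r (- r) z) (L2 r (- r) z)
position r z 0<U U<z
  with z - + 2 * (r * r) in w≡ | M2-pronic≡ r z | -pronic-L2≡ r z
... | + 0 | _ | _ =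
  zero-inside refl (M2≤0≤L2-at-roots r z (inj₂ (ℤ.i-j≡0⇒i≡j z _ w≡)))
... | -[1+ 0 ] | _ | _ =
  zero-inside refl (M2≤0≤L2-at-roots r z (inj₁ (Equivalence.to i-j≡k⇔i≡j+k w≡)))
... | +[1+ n ] | M2-q≡ | _ = outside (+<+ (s≤s z≤n)) (inj₁ (0<i-j⇒j<i 0<M2-q))
  where
  2U<z : + 2 * (r * r) < z
  2U<z = 0<i-j⇒j<i (subst (+ 0 <_) (sym w≡) (+<+ (s≤s z≤n)))
  0<M2-q : + 0 < M2 r (- r) z - pronic +[1+ n ]
  0<M2-q = subst (+ 0 <_) (sym M2-q≡)
             (0<i∧0<j⇒0<i*j {+ 2 * +[1+ n ]} (+<+ (s≤s z≤n)) (0<z[z-3]+2U 0<U 2U<z))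
... | -[1+ suc n ] | _ | -q-L2≡ = outside (+<+ (s≤s z≤n)) (inj₂ (0<i-j⇒j<i 0<-q-L2))
  where
  0<-q-L2 : + 0 < - pronic -[1+ suc n ] - L2 r (- r) z
  0<-q-L2 = subst (+ 0 <_) (sym -q-L2≡)
              (0<i∧0<j⇒0<i*j { - (+ 2 * -[1+ n ])} (+<+ (s≤s z≤n))
                             (i<j⇒0<j-i (2U<z²+z (ℤ.<⇒≤ 0<U) U<z)))

lemma6p15 : (r : ℤ) → + 2 ≤ r → (z : ℤ) → r * r < z →
    ((+ 0 ≤ S r (- r) z × M2 r (- r) z ≤√ S r (- r) z × √ S r (- r) z ≤ L2 r (- r) z) ⇔ (S r (- r) z ≡ + 0))
    × ((+ 0 ≤ S r (- r) z × M2 r (- r) z ≤-√ S r (- r) z × -√ S r (- r) z ≤ L2 r (- r) z) ⇔ (S r (- r) z ≡ + 0))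
    × ((S r (- r) z ≡ + 0) ⇔ (z ≡ + 2 * (r * r) - + 1 ⊎ z ≡ + 2 * (r * r)))
lemma6p15 r 2≤r z r²<z =
  let (i⇔iii , ii⇔iii) = Between⇔≡0 (S≡sq[pronic] r z) (position r z 0<r² r²<z)
  in  i⇔iii , ii⇔iii , S≡0⇔root r z
  where
  0<r : + 0 < r
  0<r = ℤ.<-≤-trans (+<+ (s≤s z≤n)) 2≤r
  0<r² : + 0 < r * r
  0<r² = 0<i∧0<j⇒0<i*j 0<r 0<r
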